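{- Let $b\ge2$ and $k\ge0$ be integers, and let $A\subseteq\{0,1,\ldots,k\}$ be nonempty. Let $f\in\mathcal{M}^b$ be the element with set-array representation $(A,\emptyset,\ldots,\emptyset)$. Then $d(f)\le d([k]_b)$, and the inequality is strict if $f\neq[k]_b$.
   Context: $\mathbb{N}=\{0,1,2,\ldots\}$, $[k]=\{0,\ldots,k\}$, $X+Y=\{x+y:x\in X,y\in Y\}$, $X+\emptyset=\emptyset$. $\mathcal{M}^b$ is the set of functions $f:\mathbb{N}\to\{0,\ldots,b\}$ with finite support; the set-array representation of $f$ is $(A_1,\ldots,A_b)$ with $A_i=\{a:f(a)\ge i\}$, which determines $f$. The sum of $f,g\in\mathcal{M}^b$ with set arrays $(A_i),(B_i)$ is the element with set array $(A_1+B_1,\ldots,A_b+B_b)$. $g\in\mathcal{M}^b$ is a divisor of $f$ if $f=g+h$ for some $h\in\mathcal{M}^b$; $d(f)$ (for $f$ not identically $0$) is the number of divisors of $f$. $[k]_b$ is the element of $\mathcal{M}^b$ with set array $([k],\emptyset,\ldots,\emptyset)$. -}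

module Defs where

open import Data.Nat using (ℕ; zero; suc; _+_; _≤_; _≤ᵇ_; _≡ᵇ_)
open import Relation.Binary.PropositionalEquality using (_≡_)
open import Data.Bool using (Bool; true; false; _∧_; not; T)
open import Data.List using (List; []; _∷_)
open import Data.List.Membership.Propositional using (_∈_)
open import Data.List.Relation.Unary.Unique.Propositional using (Unique)
open import Data.Product using (Σ; _×_; _,_; ∃-syntax)
open import Function.Bundles using (_⇔_)
open import Relation.Nullary using (¬_)

-- An element f of 𝓜^b (f : ℕ → {0,…,b} with finite support) is encoded
-- canonically by its list of values [f 0, f 1, …, f n] with no trailing
-- zeros (the zero function is the empty list).  With this canonical
-- encoding, propositional equality ≡ on 𝓜 b is equality of functions.

lastNonzero : List ℕ → Bool
lastNonzero []           = true
lastNonzero (x ∷ [])     = not (x ≡ᵇ 0)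
lastNonzero (x ∷ y ∷ l)  = lastNonzero (y ∷ l)

valid : ℕ → List ℕ → Bool
allLeq : ℕ → List ℕ → Bool
allLeq b []      = true
allLeq b (x ∷ l) = (x ≤ᵇ b) ∧ allLeq b l

valid b l = allLeq b l ∧ lastNonzero l

𝓜 : ℕ → Set
𝓜 b = Σ (List ℕ) (λ l → T (valid b l))

at : List ℕ → ℕ → ℕ
at []      a       = 0
at (x ∷ l) zero    = x
at (x ∷ l) (suc a) = at l a

val : ∀ {b} → 𝓜 b → ℕ → ℕ
val (l , _) = at l

-- a ∈ A_i, where (A_1,…,A_b) is the set-array representation of f
-- (A_i = { a : f(a) ≥ i })
_∈SA_at_ : ℕ → ∀ {b} → 𝓜 b → ℕ → Set
a ∈SA f at i = i ≤ val f a

IsSum : (b : ℕ) → 𝓜 b → 𝓜 b → 𝓜 b → Set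
IsSum b g h f = ∀ i a → 1 ≤ i → i ≤ b →
  (a ∈SA f at i) ⇔ (∃[ x ] ∃[ y ] (x + y ≡ a × x ∈SA g at i × y ∈SA h at i))

Divides : (b : ℕ) → 𝓜 b → 𝓜 b → Set
Divides b g f = ∃[ h ] IsSum b g h f

-- gs is a duplicate-free list of exactly the divisors of f;
-- hence d(f) = length gs
IsDivisorList : (b : ℕ) → 𝓜 b → List (𝓜 b) → Set
IsDivisorList b f gs = Unique gs × (∀ g → (g ∈ gs) ⇔ Divides b g f)

HasSetArray₁ : (b : ℕ) → 𝓜 b → (ℕ → Set) → Set
HasSetArray₁ b f A =
  (∀ a → (a ∈SA f at 1) ⇔ A a) ×
  (∀ i a → 2 ≤ i → i ≤ b → ¬ (a ∈SA f at i))

-- A divisor g of f, say f = g + h, is determined by the interval [σ, τ] spanned by its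
-- support together with its values there, and σ + min h = m := min A.  Encode g as the
-- element of 𝓜^b that takes g's values on [0, τ - σ] (shifted down by σ), except that it
-- is 1 wherever f(j + m) = 0 -- positions that g + h forces g to leave empty -- followed by
-- a block of length m whose first σ entries are 2 and whose others are 1.  The block pins
-- down σ (this needs b ≥ 2), so the encoding is injective on divisors.  Its support is
-- [0, M] with M = τ + min h ≤ max A ≤ k, and its remaining gaps sit where f is nonzero,
-- hence are covered by translates of [0, k - M]: so it is a divisor of [k]_b, giving
-- d(f) ≤ d([k]_b).  If f ≠ [k]_b, then min A > 0, max A < k, or A has a gap; accordingly
-- the divisor [0]_b, [k]_b or [k-1]_b of [k]_b is not an encoding.

module Submission where

open import Defs
open import Data.Nat using (ℕ; zero; suc; pred; _+_; _∸_; _≤_; _<_; z≤n; s≤s; _≤?_; _<?_; _≟_; _≤ᵇ_)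
open import Data.Nat.Properties
open import Algebra.Properties.CommutativeSemigroup +-commutativeSemigroup using (interchange; x∙yz≈y∙zx)
open import Data.Bool using (true; false; T; if_then_else_)
open import Data.Bool.Properties using (T-∧; T-irrelevant)
open import Data.Unit using (tt)
open import Data.Empty using (⊥-elim)
open import Data.List using (List; []; _∷_; length; foldr; applyUpTo; upTo; cartesianProductWith; filter; deduplicate)
open import Data.List.Properties using (≡-dec; length-removeAt′)
open import Data.List.Membership.Propositional using (_∈_; lose)
open import Data.List.Membership.Propositional.Properties
  using (∈-upTo⁺; ∈-cartesianProductWith⁺; ∈-filter⁺; ∈-filter⁻; ∈-deduplicate⁺; ∈-deduplicate⁻)
open import Data.List.Relation.Unary.Any using (here; there; any?; satisfied; index; _─_)
import Data.List.Relation.Unary.All as All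
open import Data.List.Relation.Unary.AllPairs using (_∷_)
open import Data.List.Relation.Unary.Unique.Propositional using (Unique)
open import Data.List.Relation.Unary.Unique.DecPropositional.Properties using (deduplicate-!)
open import Data.Product using (_×_; _,_; proj₁; proj₂; ∃-syntax; uncurry)
open import Data.Sum using (_⊎_; inj₁; inj₂)
open import Function.Base using (case_of_)
open import Function.Bundles using (_⇔_; mk⇔; Equivalence)
open import Relation.Nullary using (¬_; ¬?; Dec; yes; no; does)
open import Relation.Nullary.Decidable using (T?; dec-true; dec-false; map′; _×-dec_; _→-dec_; decidable-stable)
open import Relation.Binary.Definitions using (DecidableEquality)
open import Relation.Binary.PropositionalEquality using (_≡_; _≢_; refl; sym; trans; cong; cong₂; subst; subst₂; module ≡-Reasoning)

open Equivalence using (to; from)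

module _ {A : Set} {x y : A} {P : Set} where

  if-yes : (p? : Dec P) → P → (if does p? then x else y) ≡ x
  if-yes p? p = cong (if_then x else y) (dec-true p? p)

  if-no : (p? : Dec P) → ¬ P → (if does p? then x else y) ≡ y
  if-no p? ¬p = cong (if_then x else y) (dec-false p? ¬p)

1≤n⊎n≡0 : ∀ n → 1 ≤ n ⊎ n ≡ 0
1≤n⊎n≡0 zero    = inj₂ refl
1≤n⊎n≡0 (suc n) = inj₁ (s≤s z≤n)

boundary : {P : ℕ → Set} → (∀ n → Dec (P n)) → P 0 → ∀ x → ¬ P x → ∃[ j ] (suc j ≤ x × P j × ¬ P (suc j))
boundary P? p₀ zero    ¬p₀     = ⊥-elim (¬p₀ p₀)
boundary P? p₀ (suc x) ¬p[1+x] with P? x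
... | yes pₓ = x , ≤-refl , pₓ , ¬p[1+x]
... | no ¬pₓ with boundary P? p₀ x ¬pₓ
...   | j , 1+j≤x , pⱼ , ¬p[1+j] = j , m≤n⇒m≤1+n 1+j≤x , pⱼ , ¬p[1+j]

_⇔-dec_ : {P Q : Set} → Dec P → Dec Q → Dec (P ⇔ Q)
p? ⇔-dec q? = map′ (uncurry mk⇔) (λ e → to e , from e) ((p? →-dec q?) ×-dec (q? →-dec p?))

-- Lists as finitely supported functions

at-≥length : ∀ l a → length l ≤ a → at l a ≡ 0
at-≥length []      a       _         = refl
at-≥length (x ∷ l) (suc a) (s≤s l≤a) = at-≥length l a l≤a

at>0⇒<length : ∀ l a → 1 ≤ at l a → a < length l
at>0⇒<length l a p with length l ≤? a
... | yes l≤a = ⊥-elim (n≮0 (subst (1 ≤_) (at-≥length l a l≤a) p))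
... | no  l≰a = ≰⇒> l≰a

lastNonzero⇒at-last>0 : ∀ x l → T (lastNonzero (x ∷ l)) → 1 ≤ at (x ∷ l) (length l)
lastNonzero⇒at-last>0 (suc x) []      _ = s≤s z≤n
lastNonzero⇒at-last>0 x       (y ∷ l) p = lastNonzero⇒at-last>0 y l p

lastNonzero-tail : ∀ x l → T (lastNonzero (x ∷ l)) → T (lastNonzero l)
lastNonzero-tail x []      _ = tt
lastNonzero-tail x (y ∷ l) p = p

at-injective : ∀ l₁ l₂ → T (lastNonzero l₁) → T (lastNonzero l₂) →
               (∀ a → at l₁ a ≡ at l₂ a) → l₁ ≡ l₂
at-injective []       []       _  _  _ = refl
at-injective []       (y ∷ l₂) _  p₂ e =
  ⊥-elim (n≮0 (subst (1 ≤_) (sym (e (length l₂))) (lastNonzero⇒at-last>0 y l₂ p₂)))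
at-injective (x ∷ l₁) []       p₁ _  e =
  ⊥-elim (n≮0 (subst (1 ≤_) (e (length l₁)) (lastNonzero⇒at-last>0 x l₁ p₁)))
at-injective (x ∷ l₁) (y ∷ l₂) p₁ p₂ e with e 0
... | refl = cong (x ∷_) (at-injective l₁ l₂ (lastNonzero-tail x l₁ p₁) (lastNonzero-tail y l₂ p₂) (λ a → e (suc a)))

allLeq⇒at-≤ : ∀ {b} l a → T (allLeq b l) → at l a ≤ b
allLeq⇒at-≤     []      a       _ = z≤n
allLeq⇒at-≤ {b} (x ∷ l) zero    p = ≤ᵇ⇒≤ x b (proj₁ (to T-∧ p))
allLeq⇒at-≤ {b} (x ∷ l) (suc a) p = allLeq⇒at-≤ l a (proj₂ (to (T-∧ {x ≤ᵇ b}) p))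

at-≤⇒allLeq : ∀ {b} l → (∀ a → at l a ≤ b) → T (allLeq b l)
at-≤⇒allLeq []      _ = tt
at-≤⇒allLeq (x ∷ l) h = from T-∧ (≤⇒≤ᵇ (h 0) , at-≤⇒allLeq l (λ a → h (suc a)))

leadingZeros : List ℕ → ℕ
leadingZeros []          = 0
leadingZeros (zero  ∷ l) = suc (leadingZeros l)
leadingZeros (suc _ ∷ l) = 0

leadingZeros-≤ : ∀ l x → 1 ≤ at l x → leadingZeros l ≤ x
leadingZeros-≤ (zero  ∷ l) (suc x) p = s≤s (leadingZeros-≤ l x p)
leadingZeros-≤ (suc _ ∷ l) x       p = z≤n

at-leadingZeros>0 : ∀ l x → 1 ≤ at l x → 1 ≤ at l (leadingZeros l)
at-leadingZeros>0 (zero  ∷ l) (suc x) p = at-leadingZeros>0 l x p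
at-leadingZeros>0 (suc _ ∷ l) x       p = s≤s z≤n

infixr 5 _∷⁺_
_∷⁺_ : ℕ → List ℕ → List ℕ
x     ∷⁺ y ∷ l = x ∷ y ∷ l
zero  ∷⁺ []    = []
suc x ∷⁺ []    = suc x ∷ []

dropTrailingZeros : List ℕ → List ℕ
dropTrailingZeros = foldr _∷⁺_ []

at-∷⁺ : ∀ x l a → at (x ∷⁺ l) a ≡ at (x ∷ l) a
at-∷⁺ x       (y ∷ l) a       = refl
at-∷⁺ zero    []      zero    = refl
at-∷⁺ zero    []      (suc a) = refl
at-∷⁺ (suc x) []      a       = refl

at-dropTrailingZeros : ∀ l a → at (dropTrailingZeros l) a ≡ at l a
at-dropTrailingZeros []      a       = refl
at-dropTrailingZeros (x ∷ l) zero    = at-∷⁺ x (dropTrailingZeros l) zero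
at-dropTrailingZeros (x ∷ l) (suc a) = trans (at-∷⁺ x (dropTrailingZeros l) (suc a)) (at-dropTrailingZeros l a)

lastNonzero-∷⁺ : ∀ x l → T (lastNonzero l) → T (lastNonzero (x ∷⁺ l))
lastNonzero-∷⁺ x       (y ∷ l) p = p
lastNonzero-∷⁺ zero    []      _ = tt
lastNonzero-∷⁺ (suc x) []      _ = tt

lastNonzero-dropTrailingZeros : ∀ l → T (lastNonzero (dropTrailingZeros l))
lastNonzero-dropTrailingZeros []      = tt
lastNonzero-dropTrailingZeros (x ∷ l) = lastNonzero-∷⁺ x (dropTrailingZeros l) (lastNonzero-dropTrailingZeros l)

at-applyUpTo : ∀ F n → (∀ a → n ≤ a → F a ≡ 0) → ∀ a → at (applyUpTo F n) a ≡ F a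
at-applyUpTo F zero    F≡0 a       = sym (F≡0 a z≤n)
at-applyUpTo F (suc n) F≡0 zero    = refl
at-applyUpTo F (suc n) F≡0 (suc a) = at-applyUpTo (λ a → F (suc a)) n (λ a n≤a → F≡0 (suc a) (s≤s n≤a)) a

module _ {b : ℕ} where

  Nonzero : 𝓜 b → Set
  Nonzero g = ∃[ a ] 1 ≤ val g a

  𝓜-≡ : {g h : 𝓜 b} → proj₁ g ≡ proj₁ h → g ≡ h
  𝓜-≡ {l , p} {.l , q} refl = cong (l ,_) (T-irrelevant p q)

  _≟𝓜_ : DecidableEquality (𝓜 b)
  g ≟𝓜 h with ≡-dec _≟_ (proj₁ g) (proj₁ h)
  ... | yes e = yes (𝓜-≡ e)
  ... | no ¬e = no (λ e → ¬e (cong proj₁ e))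

  val-≤ : (g : 𝓜 b) → ∀ a → val g a ≤ b
  val-≤ (l , p) a = allLeq⇒at-≤ l a (proj₁ (to T-∧ p))

  val>0⇒<length : (g : 𝓜 b) → ∀ a → 1 ≤ val g a → a < length (proj₁ g)
  val>0⇒<length (l , _) = at>0⇒<length l

  𝓜-ext : (g h : 𝓜 b) → (∀ a → val g a ≡ val h a) → g ≡ h
  𝓜-ext (l₁ , p₁) (l₂ , p₂) e =
    𝓜-≡ (at-injective l₁ l₂ (proj₂ (to (T-∧ {allLeq b l₁}) p₁)) (proj₂ (to (T-∧ {allLeq b l₂}) p₂)) e)

  -- Both are 0 on the zero element; lemmas about attained values assume Nonzero.
  minSupp maxSupp : 𝓜 b → ℕ
  minSupp g = leadingZeros (proj₁ g)
  maxSupp g = pred (length (proj₁ g))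

  minSupp-≤ : (g : 𝓜 b) → ∀ x → 1 ≤ val g x → minSupp g ≤ x
  minSupp-≤ g = leadingZeros-≤ (proj₁ g)

  ≤-maxSupp : (g : 𝓜 b) → ∀ x → 1 ≤ val g x → x ≤ maxSupp g
  ≤-maxSupp g x p = <⇒≤pred (val>0⇒<length g x p)

  val-minSupp>0 : (g : 𝓜 b) → Nonzero g → 1 ≤ val g (minSupp g)
  val-minSupp>0 g (x , p) = at-leadingZeros>0 (proj₁ g) x p

  val-maxSupp>0 : (g : 𝓜 b) → Nonzero g → 1 ≤ val g (maxSupp g)
  val-maxSupp>0 ([]    , _) (_ , ())
  val-maxSupp>0 (y ∷ l , p) _ = lastNonzero⇒at-last>0 y l (proj₂ (to (T-∧ {allLeq b (y ∷ l)}) p))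

  <minSupp⇒val≡0 : (g : 𝓜 b) → ∀ x → x < minSupp g → val g x ≡ 0
  <minSupp⇒val≡0 g x x<min with 1≤n⊎n≡0 (val g x)
  ... | inj₁ p = ⊥-elim (<⇒≱ x<min (minSupp-≤ g x p))
  ... | inj₂ e = e

  >maxSupp⇒val≡0 : (g : 𝓜 b) → ∀ x → maxSupp g < x → val g x ≡ 0
  >maxSupp⇒val≡0 g x max<x with 1≤n⊎n≡0 (val g x)
  ... | inj₁ p = ⊥-elim (<⇒≱ max<x (≤-maxSupp g x p))
  ... | inj₂ e = e

  maxSupp-unique : (g : 𝓜 b) → ∀ x → 1 ≤ val g x → (∀ y → 1 ≤ val g y → y ≤ x) → maxSupp g ≡ x
  maxSupp-unique g x p max = ≤-antisym (max (maxSupp g) (val-maxSupp>0 g (x , p))) (≤-maxSupp g x p)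

  fromFunction : (F : ℕ → ℕ) (N : ℕ) → (∀ a → F a ≤ b) → (∀ a → N < a → F a ≡ 0) → 𝓜 b
  fromFunction F N F≤b F≡0 = l , from T-∧ (at-≤⇒allLeq l at-l≤b , lastNonzero-dropTrailingZeros (applyUpTo F (suc N)))
    where
      l : List ℕ
      l = dropTrailingZeros (applyUpTo F (suc N))
      at-l≤b : ∀ a → at l a ≤ b
      at-l≤b a rewrite at-dropTrailingZeros (applyUpTo F (suc N)) a | at-applyUpTo F (suc N) F≡0 a = F≤b a

  val-fromFunction : ∀ F N F≤b F≡0 a → val (fromFunction F N F≤b F≡0) a ≡ F a
  val-fromFunction F N F≤b F≡0 a =
    trans (at-dropTrailingZeros (applyUpTo F (suc N)) a) (at-applyUpTo F (suc N) F≡0 a)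

  length-≤ : (g : 𝓜 b) → ∀ n → (∀ x → 1 ≤ val g x → x < n) → length (proj₁ g) ≤ n
  length-≤ ([]    , _) n _   = z≤n
  length-≤ (y ∷ l , p) n supp<n = supp<n (length l) (lastNonzero⇒at-last>0 y l (proj₂ (to (T-∧ {allLeq b (y ∷ l)}) p)))

  minSupp-≤-maxSupp : (g : 𝓜 b) → Nonzero g → minSupp g ≤ maxSupp g
  minSupp-≤-maxSupp g g≢0 = minSupp-≤ g (maxSupp g) (val-maxSupp>0 g g≢0)

module _ {b : ℕ} where

  _∈SA_⊕_at_ : ℕ → 𝓜 b → 𝓜 b → ℕ → Set
  a ∈SA g ⊕ h at i = ∃[ x ] ∃[ y ] (x + y ≡ a × x ∈SA g at i × y ∈SA h at i)

  _∈SA?_⊕_at_ : ∀ a g h i → Dec (a ∈SA g ⊕ h at i)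
  a ∈SA? g ⊕ h at i =
    map′ (λ (x , x<1+a , gx , hy) → x , a ∸ x , m+[n∸m]≡n (≤-pred x<1+a) , gx , hy)
         (λ { (x , y , refl , gx , hy) → x , s≤s (m≤m+n x y) , gx , subst (λ z → i ≤ val h z) (sym (m+n∸m≡n x y)) hy })
         (anyUpTo? (λ x → (i ≤? val g x) ×-dec (i ≤? val h (a ∸ x))) (suc a))

  IsSum? : (g h f : 𝓜 b) → Dec (IsSum b g h f)
  IsSum? g h f = map′ fromBounded toBounded (allUpTo? (λ i → allUpTo? (λ a → level? i a) B) (suc b))
    where
      B : ℕ
      B = length (proj₁ g) + length (proj₁ h) + length (proj₁ f)

      Level : ℕ → ℕ → Set
      Level i a = 1 ≤ i → (a ∈SA f at i) ⇔ (a ∈SA g ⊕ h at i)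

      level? : ∀ i a → Dec (Level i a)
      level? i a = (1 ≤? i) →-dec ((i ≤? val f a) ⇔-dec (a ∈SA? g ⊕ h at i))

      Bounded : Set
      Bounded = ∀ {i} → i < suc b → ∀ {a} → a < B → Level i a

      toBounded : IsSum b g h f → Bounded
      toBounded s i<1+b a<B 1≤i = s _ _ 1≤i (≤-pred i<1+b)

      fromBounded : Bounded → IsSum b g h f
      fromBounded bd i a 1≤i i≤b with a <? B
      ... | yes a<B = bd (s≤s i≤b) a<B 1≤i
      ... | no  a≮B = mk⇔ (λ fa → ⊥-elim (a≮B (f-bound fa))) (λ gh → ⊥-elim (a≮B (gh-bound gh)))
        where
          f-bound : a ∈SA f at i → a < B
          f-bound fa = <-≤-trans (val>0⇒<length f a (≤-trans 1≤i fa)) (m≤n+m _ _)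
          gh-bound : a ∈SA g ⊕ h at i → a < B
          gh-bound (x , y , refl , gx , hy) =
            <-≤-trans (+-mono-< (val>0⇒<length g x (≤-trans 1≤i gx)) (val>0⇒<length h y (≤-trans 1≤i hy)))
                      (m≤m+n _ _)

  IsSum-comm : (g h f : 𝓜 b) → IsSum b g h f → IsSum b h g f
  IsSum-comm g h f s i a 1≤i i≤b =
    mk⇔ (λ fa → swap g h (to (s i a 1≤i i≤b) fa)) (λ hg → from (s i a 1≤i i≤b) (swap h g hg))
    where
      swap : ∀ g h → a ∈SA g ⊕ h at i → a ∈SA h ⊕ g at i
      swap _ _ (x , y , refl , gx , hy) = y , x , +-comm y x , hy , gx

module _ {b : ℕ} (1≤b : 1 ≤ b) (g h f : 𝓜 b) (s : IsSum b g h f) where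

  ∈SA-split : ∀ a → 1 ≤ val f a → a ∈SA g ⊕ h at 1
  ∈SA-split a = to (s 1 a ≤-refl 1≤b)

  ∈SA-sum : ∀ x y → 1 ≤ val g x → 1 ≤ val h y → 1 ≤ val f (x + y)
  ∈SA-sum x y gx hy = from (s 1 (x + y) ≤-refl 1≤b) (x , y , refl , gx , hy)

  summand-nonzero : Nonzero f → Nonzero g × Nonzero h
  summand-nonzero (a , fa) with ∈SA-split a fa
  ... | x , y , _ , gx , hy = (x , gx) , (y , hy)

  module _ (f≢0 : Nonzero f) where

    private
      g≢0 : Nonzero g
      g≢0 = proj₁ (summand-nonzero f≢0)
      h≢0 : Nonzero h
      h≢0 = proj₂ (summand-nonzero f≢0)

    minSupp-sum : minSupp f ≡ minSupp g + minSupp h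
    minSupp-sum with ∈SA-split (minSupp f) (val-minSupp>0 f f≢0)
    ... | x , y , x+y≡min , gx , hy =
      ≤-antisym (minSupp-≤ f _ (∈SA-sum _ _ (val-minSupp>0 g g≢0) (val-minSupp>0 h h≢0)))
                (subst (_ ≤_) x+y≡min (+-mono-≤ (minSupp-≤ g x gx) (minSupp-≤ h y hy)))

    maxSupp-sum : maxSupp f ≡ maxSupp g + maxSupp h
    maxSupp-sum with ∈SA-split (maxSupp f) (val-maxSupp>0 f f≢0)
    ... | x , y , x+y≡max , gx , hy =
      ≤-antisym (subst (_≤ maxSupp g + maxSupp h) x+y≡max (+-mono-≤ (≤-maxSupp g x gx) (≤-maxSupp h y hy)))
                (≤-maxSupp f _ (∈SA-sum _ _ (val-maxSupp>0 g g≢0) (val-maxSupp>0 h h≢0)))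

    length-summand-≤ : length (proj₁ g) ≤ length (proj₁ f)
    length-summand-≤ = length-≤ g _ λ x gx →
      ≤-<-trans (m≤m+n x _) (val>0⇒<length f _ (∈SA-sum x _ gx (proj₂ h≢0)))

-- Finite lists of divisors

boundedLists : ℕ → ℕ → List (List ℕ)
boundedLists b zero    = [] ∷ []
boundedLists b (suc n) = [] ∷ cartesianProductWith _∷_ (upTo (suc b)) (boundedLists b n)

∈-boundedLists : ∀ b n l → length l ≤ n → T (allLeq b l) → l ∈ boundedLists b n
∈-boundedLists b zero    []      _         _ = here refl
∈-boundedLists b (suc n) []      _         _ = here refl
∈-boundedLists b (suc n) (x ∷ l) (s≤s l≤n) p =
  there (∈-cartesianProductWith⁺ _∷_ (∈-upTo⁺ (s≤s (≤ᵇ⇒≤ x b (proj₁ (to T-∧ p)))))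
                                     (∈-boundedLists b n l l≤n (proj₂ (to (T-∧ {x ≤ᵇ b}) p))))

validOnly : ∀ b → List (List ℕ) → List (𝓜 b)
validOnly b []       = []
validOnly b (l ∷ ls) with T? (valid b l)
... | yes p = (l , p) ∷ validOnly b ls
... | no  _ = validOnly b ls

∈-validOnly : ∀ b ls (g : 𝓜 b) → proj₁ g ∈ ls → g ∈ validOnly b ls
∈-validOnly b (l ∷ ls) g (here refl) with T? (valid b l)
... | yes p = here (𝓜-≡ refl)
... | no ¬p = ⊥-elim (¬p (proj₂ g))
∈-validOnly b (l ∷ ls) g (there g∈ls) with T? (valid b l)
... | yes _ = there (∈-validOnly b ls g g∈ls)
... | no  _ = ∈-validOnly b ls g g∈ls

∈-validOnly-boundedLists : ∀ b n (g : 𝓜 b) → length (proj₁ g) ≤ n → g ∈ validOnly b (boundedLists b n)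
∈-validOnly-boundedLists b n g l≤n =
  ∈-validOnly b _ g (∈-boundedLists b n _ l≤n (proj₁ (to (T-∧ {allLeq b (proj₁ g)}) (proj₂ g))))

divisorList : ∀ {b} → 1 ≤ b → (f : 𝓜 b) → Nonzero f → ∃[ gs ] IsDivisorList b f gs
divisorList {b} 1≤b f f≢0 =
  deduplicate _≟𝓜_ (filter Divides? candidates) ,
  deduplicate-! _≟𝓜_ (filter Divides? candidates) ,
  λ g → mk⇔ (λ g∈ → proj₂ (∈-filter⁻ Divides? {xs = candidates} (∈-deduplicate⁻ _≟𝓜_ (filter Divides? candidates) g∈)))
            (λ g∣f → ∈-deduplicate⁺ _≟𝓜_ (∈-filter⁺ Divides? (candidate g g∣f) g∣f))
  where
    candidates : List (𝓜 b)
    candidates = validOnly b (boundedLists b (length (proj₁ f)))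

    candidate : ∀ g → Divides b g f → g ∈ candidates
    candidate g (h , s) = ∈-validOnly-boundedLists b _ g (length-summand-≤ 1≤b g h f s f≢0)

    Divides? : ∀ g → Dec (Divides b g f)
    Divides? g = map′ satisfied
                      (λ (h , s) → lose (candidate h (g , IsSum-comm g h f s)) s)
                      (any? (λ h → IsSum? g h f) candidates)

-- Comparing divisor counts by injections

module _ {A B : Set} where

  ∈-─ : ∀ {x z : B} (ys : List B) (x∈ys : x ∈ ys) → z ∈ ys → z ≢ x → z ∈ (ys ─ x∈ys)
  ∈-─ (y ∷ ys) (here refl)  (here z≡y)  z≢y = ⊥-elim (z≢y z≡y)
  ∈-─ (y ∷ ys) (here refl)  (there z∈ys) _  = z∈ys
  ∈-─ (y ∷ ys) (there x∈ys) (here z≡y)  _   = here z≡y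
  ∈-─ (y ∷ ys) (there x∈ys) (there z∈ys) z≢x = there (∈-─ ys x∈ys z∈ys z≢x)

  length-≤-injection : (φ : A → B) (xs : List A) (ys : List B) → Unique xs →
                       (∀ {x} → x ∈ xs → φ x ∈ ys) →
                       (∀ {x x′} → x ∈ xs → x′ ∈ xs → φ x ≡ φ x′ → x ≡ x′) →
                       length xs ≤ length ys
  length-≤-injection φ []       ys _           _    _   = z≤n
  length-≤-injection φ (x ∷ xs) ys (x∉xs ∷ u) maps inj =
    subst (suc (length xs) ≤_) (sym (length-removeAt′ ys (index φx∈ys)))
      (s≤s (length-≤-injection φ xs (ys ─ φx∈ys) u
              (λ x′∈xs → ∈-─ ys φx∈ys (maps (there x′∈xs))
                           (λ e → All.lookup x∉xs x′∈xs (sym (inj (there x′∈xs) (here refl) e))))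
              (λ x₁∈xs x₂∈xs → inj (there x₁∈xs) (there x₂∈xs))))
    where
      φx∈ys : φ x ∈ ys
      φx∈ys = maps (here refl)

  length-<-injection : (φ : A → B) (xs : List A) (ys : List B) → Unique xs →
                       (∀ {x} → x ∈ xs → φ x ∈ ys) →
                       (∀ {x x′} → x ∈ xs → x′ ∈ xs → φ x ≡ φ x′ → x ≡ x′) →
                       ∀ {y} → y ∈ ys → (∀ {x} → x ∈ xs → φ x ≢ y) →
                       length xs < length ys
  length-<-injection φ xs ys u maps inj y∈ys ≢y =
    subst (suc (length xs) ≤_) (sym (length-removeAt′ ys (index y∈ys)))
      (s≤s (length-≤-injection φ xs (ys ─ y∈ys) u (λ x∈xs → ∈-─ ys y∈ys (maps x∈xs) (≢y x∈xs)) inj))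

record DivisorEmbedding {b : ℕ} (f f′ : 𝓜 b) : Set where
  field
    embed           : 𝓜 b → 𝓜 b
    embed-divides   : ∀ {g} → Divides b g f → Divides b (embed g) f′
    embed-injective : ∀ {g₁ g₂} → Divides b g₁ f → Divides b g₂ f → embed g₁ ≡ embed g₂ → g₁ ≡ g₂

module _ {b : ℕ} {f f′ : 𝓜 b} (E : DivisorEmbedding f f′)
         {gs hs : List (𝓜 b)} (gs-ok : IsDivisorList b f gs) (hs-ok : IsDivisorList b f′ hs) where

  open DivisorEmbedding E

  private
    maps : ∀ {g} → g ∈ gs → embed g ∈ hs
    maps g∈gs = from (proj₂ hs-ok _) (embed-divides (to (proj₂ gs-ok _) g∈gs))

    injective : ∀ {g₁ g₂} → g₁ ∈ gs → g₂ ∈ gs → embed g₁ ≡ embed g₂ → g₁ ≡ g₂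
    injective g₁∈gs g₂∈gs = embed-injective (to (proj₂ gs-ok _) g₁∈gs) (to (proj₂ gs-ok _) g₂∈gs)

  divisorList-length-≤ : length gs ≤ length hs
  divisorList-length-≤ = length-≤-injection embed gs hs (proj₁ gs-ok) maps injective

  divisorList-length-< : ∀ {e} → Divides b e f′ → (∀ {g} → Divides b g f → embed g ≢ e) →
                         length gs < length hs
  divisorList-length-< e∣f′ ≢e = length-<-injection embed gs hs (proj₁ gs-ok) maps injective
                                   (from (proj₂ hs-ok _) e∣f′) (λ g∈gs → ≢e (to (proj₂ gs-ok _) g∈gs))

module Intervals {b : ℕ} (1≤b : 1 ≤ b) where

  indicator : ℕ → ℕ → ℕ
  indicator c a = if does (a ≤? c) then 1 else 0

  indicator-≤ : ∀ c a → indicator c a ≤ b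
  indicator-≤ c a with does (a ≤? c)
  ... | true  = 1≤b
  ... | false = z≤n

  indicator-> : ∀ c a → c < a → indicator c a ≡ 0
  indicator-> c a c<a = if-no (a ≤? c) (<⇒≱ c<a)

  interval : ℕ → 𝓜 b
  interval c = fromFunction (indicator c) c (indicator-≤ c) (indicator-> c)

  val-interval-≤ : ∀ c a → a ≤ c → val (interval c) a ≡ 1
  val-interval-≤ c a a≤c = trans (val-fromFunction (indicator c) c (indicator-≤ c) (indicator-> c) a) (if-yes (a ≤? c) a≤c)

  val-interval-> : ∀ c a → c < a → val (interval c) a ≡ 0
  val-interval-> c a c<a = trans (val-fromFunction (indicator c) c (indicator-≤ c) (indicator-> c) a) (indicator-> c a c<a)

  ∈interval : ∀ c a → 1 ≤ val (interval c) a ⇔ a ≤ c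
  ∈interval c a with a ≤? c
  ... | yes a≤c = mk⇔ (λ _ → a≤c) (λ _ → ≤-reflexive (sym (val-interval-≤ c a a≤c)))
  ... | no  a≰c = mk⇔ (λ p → ⊥-elim (n≮0 (subst (1 ≤_) (val-interval-> c a (≰⇒> a≰c)) p))) (λ a≤c → ⊥-elim (a≰c a≤c))

  ∉interval-above1 : ∀ c a {i} → 2 ≤ i → ¬ i ≤ val (interval c) a
  ∉interval-above1 c a 2≤i i≤val with a ≤? c
  ... | yes a≤c = n≮n 1 (≤-trans 2≤i (subst (_ ≤_) (val-interval-≤ c a a≤c) i≤val))
  ... | no  a≰c = n≮0 (≤-trans 2≤i (subst (_ ≤_) (val-interval-> c a (≰⇒> a≰c)) i≤val))

  maxSupp-interval : ∀ c → maxSupp (interval c) ≡ c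
  maxSupp-interval c = maxSupp-unique (interval c) c (from (∈interval c c) ≤-refl) (λ y → to (∈interval c y))

  HasSetArray₁-interval : ∀ c → HasSetArray₁ b (interval c) (_≤ c)
  HasSetArray₁-interval c = ∈interval c , λ i a 2≤i _ → ∉interval-above1 c a 2≤i

  IsSum-interval : (e : 𝓜 b) (M k : ℕ) → M ≤ k → (∀ x → 1 ≤ val e x → x ≤ M) →
                   (∀ a → a ≤ k → a ∈SA e ⊕ interval (k ∸ M) at 1) →
                   IsSum b e (interval (k ∸ M)) (interval k)
  IsSum-interval e M k M≤k supp≤M cover (suc zero) a _ _ = mk⇔ (λ p → cover a (to (∈interval k a) p)) sum≤k
    where
      sum≤k : a ∈SA e ⊕ interval (k ∸ M) at 1 → 1 ≤ val (interval k) a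
      sum≤k (x , y , refl , ex , iy) = from (∈interval k (x + y))
        (subst (x + y ≤_) (m+[n∸m]≡n M≤k) (+-mono-≤ (supp≤M x ex) (to (∈interval (k ∸ M) y) iy)))
  IsSum-interval e M k _ _ _ (suc (suc i)) a _ _ =
    mk⇔ (λ i≤val → ⊥-elim (∉interval-above1 k a (s≤s (s≤s z≤n)) i≤val))
        (λ (_ , y , _ , _ , i≤val) → ⊥-elim (∉interval-above1 (k ∸ M) y (s≤s (s≤s z≤n)) i≤val))

  interval-divides : ∀ c k → c ≤ k → Divides b (interval c) (interval k)
  interval-divides c k c≤k = interval (k ∸ c) , IsSum-interval (interval c) c k c≤k (λ x → to (∈interval c x)) cover
    where
      cover : ∀ a → a ≤ k → a ∈SA interval c ⊕ interval (k ∸ c) at 1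
      cover a a≤k with a ≤? c
      ... | yes a≤c = a , 0 , +-identityʳ a , from (∈interval c a) a≤c , from (∈interval (k ∸ c) 0) z≤n
      ... | no  a≰c = c , a ∸ c , m+[n∸m]≡n (<⇒≤ (≰⇒> a≰c)) , from (∈interval c c) ≤-refl ,
                      from (∈interval (k ∸ c) (a ∸ c)) (∸-monoˡ-≤ c a≤k)

module _ {b : ℕ} (2≤b : 2 ≤ b) where

  HasSetArray₁⇒val-≤1 : ∀ f {A} → HasSetArray₁ b f A → ∀ a → val f a ≤ 1
  HasSetArray₁⇒val-≤1 f (_ , above1-empty) a = ≤-pred (≰⇒> (above1-empty 2 a ≤-refl 2≤b))

  HasSetArray₁-unique : ∀ {f f′ A} → HasSetArray₁ b f A → HasSetArray₁ b f′ A → f ≡ f′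
  HasSetArray₁-unique {f} {f′} hf hf′ = 𝓜-ext f f′ pointwise
    where
      pointwise : ∀ a → val f a ≡ val f′ a
      pointwise a with 1≤n⊎n≡0 (val f a) | 1≤n⊎n≡0 (val f′ a)
      ... | inj₁ p | inj₁ p′ = trans (≤-antisym (HasSetArray₁⇒val-≤1 f hf a) p)
                                     (≤-antisym p′ (HasSetArray₁⇒val-≤1 f′ hf′ a))
      ... | inj₁ p | inj₂ z′ = ⊥-elim (n≮0 (subst (1 ≤_) z′ (from (proj₁ hf′ a) (to (proj₁ hf a) p))))
      ... | inj₂ z | inj₁ p′ = ⊥-elim (n≮0 (subst (1 ≤_) z (from (proj₁ hf a) (to (proj₁ hf′ a) p′))))
      ... | inj₂ z | inj₂ z′ = trans z (sym z′)

  open Intervals (<⇒≤ 2≤b)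

  ≢interval⇒gap : ∀ {f A k} → HasSetArray₁ b f A → (∀ a → A a → a ≤ k) → f ≢ interval k →
                  ∃[ x ] (x ≤ k × ¬ 1 ≤ val f x)
  ≢interval⇒gap {f} {A} {k} hf A⊆[k] f≢ with anyUpTo? (λ x → ¬? (1 ≤? val f x)) (suc k)
  ... | yes (x , x<1+k , ¬fx) = x , ≤-pred x<1+k , ¬fx
  ... | no  no-gap = ⊥-elim (f≢ (HasSetArray₁-unique (∈[k] , proj₂ hf) (HasSetArray₁-interval k)))
    where
      ∈[k] : ∀ a → 1 ≤ val f a ⇔ a ≤ k
      ∈[k] a = mk⇔ (λ fa → A⊆[k] a (to (proj₁ hf a) fa))
                   (λ a≤k → decidable-stable (1 ≤? val f a) (λ ¬fa → no-gap (a , s≤s a≤k , ¬fa)))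

-- The encoding of divisors of f as divisors of [k]_b

module Encoding {b : ℕ} (2≤b : 2 ≤ b) (f : 𝓜 b) where

  1≤b : 1 ≤ b
  1≤b = <⇒≤ 2≤b

  open Intervals 1≤b

  m : ℕ
  m = minSupp f

  width : 𝓜 b → ℕ
  width g = maxSupp g ∸ minSupp g

  code : 𝓜 b → ℕ → ℕ
  code g j =
    if does (j ≤? width g)
    then (if does (val f (j + m) ≟ 0) then 1 else val g (j + minSupp g))
    else if does (j ≤? width g + m)
    then (if does (j ≤? width g + minSupp g) then 2 else 1)
    else 0

  code-≤ : ∀ g j → code g j ≤ b
  code-≤ g j with does (j ≤? width g)
  ... | true with does (val f (j + m) ≟ 0)
  ...   | true  = 1≤b
  ...   | false = val-≤ g (j + minSupp g)
  code-≤ g j | false with does (j ≤? width g + m)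
  ...   | false = z≤n
  ...   | true with does (j ≤? width g + minSupp g)
  ...     | true  = 2≤b
  ...     | false = 1≤b

  code-> : ∀ g j → width g + m < j → code g j ≡ 0
  code-> g j w+m<j = trans (if-no (j ≤? width g) (λ j≤w → <⇒≱ w+m<j (≤-trans j≤w (m≤m+n _ m))))
                           (if-no (j ≤? width g + m) (<⇒≱ w+m<j))

  encode : 𝓜 b → 𝓜 b
  encode g = fromFunction (code g) (width g + m) (code-≤ g) (code-> g)

  val-encode : ∀ g j → val (encode g) j ≡ code g j
  val-encode g = val-fromFunction (code g) (width g + m) (code-≤ g) (code-> g)

  module _ (g : 𝓜 b) {j : ℕ} where

    private
      code-beyond-width : width g < j → code g j ≡ (if does (j ≤? width g + m) then (if does (j ≤? width g + minSupp g) then 2 else 1) else 0)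
      code-beyond-width w<j = if-no (j ≤? width g) (<⇒≱ w<j)

    code-low : j ≤ width g → 1 ≤ val f (j + m) → code g j ≡ val g (j + minSupp g)
    code-low j≤w fj = trans (if-yes (j ≤? width g) j≤w) (if-no (val f (j + m) ≟ 0) (λ z → n≮0 (subst (1 ≤_) z fj)))

    code-gap : j ≤ width g → val f (j + m) ≡ 0 → code g j ≡ 1
    code-gap j≤w z = trans (if-yes (j ≤? width g) j≤w) (if-yes (val f (j + m) ≟ 0) z)

    code-low>0 : j ≤ width g → 1 ≤ val g (j + minSupp g) → 1 ≤ code g j
    code-low>0 j≤w gj with 1≤n⊎n≡0 (val f (j + m))
    ... | inj₁ fj = subst (1 ≤_) (sym (code-low j≤w fj)) gj
    ... | inj₂ z  = ≤-reflexive (sym (code-gap j≤w z))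

    code-run : width g < j → j ≤ width g + m → j ≤ width g + minSupp g → code g j ≡ 2
    code-run w<j j≤w+m j≤w+σ =
      trans (code-beyond-width w<j) (trans (if-yes (j ≤? width g + m) j≤w+m) (if-yes (j ≤? width g + minSupp g) j≤w+σ))

    code-after-run : width g < j → j ≤ width g + m → ¬ j ≤ width g + minSupp g → code g j ≡ 1
    code-after-run w<j j≤w+m j≰w+σ =
      trans (code-beyond-width w<j) (trans (if-yes (j ≤? width g + m) j≤w+m) (if-no (j ≤? width g + minSupp g) j≰w+σ))

    code-mid>0 : width g < j → j ≤ width g + m → 1 ≤ code g j
    code-mid>0 w<j j≤w+m with j ≤? width g + minSupp g
    ... | yes j≤w+σ = ≤-trans (s≤s z≤n) (≤-reflexive (sym (code-run w<j j≤w+m j≤w+σ)))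
    ... | no  j≰w+σ = ≤-reflexive (sym (code-after-run w<j j≤w+m j≰w+σ))

    code≡2⇒≤width+minSupp : width g < j → code g j ≡ 2 → j ≤ width g + minSupp g
    code≡2⇒≤width+minSupp w<j c≡2 with j ≤? width g + minSupp g | j ≤? width g + m
    ... | yes j≤w+σ | _         = j≤w+σ
    ... | no  j≰w+σ | yes j≤w+m = case trans (sym c≡2) (code-after-run w<j j≤w+m j≰w+σ) of λ ()
    ... | no  _     | no  j≰w+m = case trans (sym c≡2) (code-> g j (≰⇒> j≰w+m)) of λ ()

  width+minSupp : (g : 𝓜 b) → Nonzero g → width g + minSupp g ≡ maxSupp g
  width+minSupp g g≢0 = m∸n+n≡m (minSupp-≤-maxSupp g g≢0)

  code-top>0 : (g : 𝓜 b) → Nonzero g → 1 ≤ code g (width g + m)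
  code-top>0 g g≢0 with 1≤n⊎n≡0 m
  ... | inj₁ 1≤m = code-mid>0 g (subst (_≤ width g + m) (+-comm (width g) 1) (+-monoʳ-≤ (width g) 1≤m)) ≤-refl
  ... | inj₂ m≡0 = subst (λ j → 1 ≤ code g j) (sym (trans (cong (width g +_) m≡0) (+-identityʳ (width g))))
    (code-low>0 g ≤-refl (subst (λ x → 1 ≤ val g x) (sym (width+minSupp g g≢0)) (val-maxSupp>0 g g≢0)))

  encode>0 : (g : 𝓜 b) → ∀ j → 1 ≤ code g j → 1 ≤ val (encode g) j
  encode>0 g j = subst (1 ≤_) (sym (val-encode g j))

  encode-supp-≤ : (g : 𝓜 b) → ∀ j → 1 ≤ val (encode g) j → j ≤ width g + m
  encode-supp-≤ g j p with j ≤? width g + m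
  ... | yes j≤ = j≤
  ... | no  j≰ = ⊥-elim (n≮0 (subst (1 ≤_) (trans (val-encode g j) (code-> g j (≰⇒> j≰))) p))

  maxSupp-encode : (g : 𝓜 b) → Nonzero g → maxSupp (encode g) ≡ width g + m
  maxSupp-encode g g≢0 = maxSupp-unique (encode g) (width g + m) (encode>0 g _ (code-top>0 g g≢0)) (encode-supp-≤ g)

  module Divisor (f≢0 : Nonzero f) (g h : 𝓜 b) (s : IsSum b g h f) where

    g≢0 : Nonzero g
    g≢0 = proj₁ (summand-nonzero 1≤b g h f s f≢0)

    h≢0 : Nonzero h
    h≢0 = proj₂ (summand-nonzero 1≤b g h f s f≢0)

    σ ρ : ℕ
    σ = minSupp g
    ρ = minSupp h

    m≡σ+ρ : m ≡ σ + ρ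
    m≡σ+ρ = minSupp-sum 1≤b g h f s f≢0

    σ≤m : σ ≤ m
    σ≤m = subst (σ ≤_) (sym m≡σ+ρ) (m≤m+n σ ρ)

    width+m≡maxSupp+ρ : width g + m ≡ maxSupp g + ρ
    width+m≡maxSupp+ρ = begin
      width g + m       ≡⟨ cong (width g +_) m≡σ+ρ ⟩
      width g + (σ + ρ) ≡⟨ +-assoc (width g) σ ρ ⟨
      width g + σ + ρ   ≡⟨ cong (_+ ρ) (width+minSupp g g≢0) ⟩
      maxSupp g + ρ     ∎
      where open ≡-Reasoning

    width+m≤maxSupp : width g + m ≤ maxSupp f
    width+m≤maxSupp = ≤-trans (≤-reflexive width+m≡maxSupp+ρ)
      (≤-maxSupp f _ (∈SA-sum 1≤b g h f s _ _ (val-maxSupp>0 g g≢0) (val-minSupp>0 h h≢0)))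

    ∈SA-shifted : ∀ j → 1 ≤ val g (j + σ) → 1 ≤ val f (j + m)
    ∈SA-shifted j gj = subst (λ a → 1 ≤ val f a) (trans (+-assoc j σ ρ) (cong (j +_) (sym m≡σ+ρ)))
                             (∈SA-sum 1≤b g h f s _ _ gj (val-minSupp>0 h h≢0))

    split-shifted : ∀ j → 1 ≤ val f (j + m) →
                    ∃[ x ] ∃[ y ] (x + y ≡ j × x ≤ width g × 1 ≤ val g (x + σ) × y ≤ maxSupp f ∸ (width g + m))
    split-shifted j fj with ∈SA-split 1≤b g h f s (j + m) fj
    ... | x′ , y′ , x′+y′≡j+m , gx′ , hy′ = x , y , x+y≡j , x≤width , gx , y≤
      where
        x y : ℕ
        x = x′ ∸ σ
        y = y′ ∸ ρ
        x+σ≡x′ : x + σ ≡ x′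
        x+σ≡x′ = m∸n+n≡m (minSupp-≤ g x′ gx′)
        ρ+y≡y′ : ρ + y ≡ y′
        ρ+y≡y′ = m+[n∸m]≡n (minSupp-≤ h y′ hy′)
        x+y≡j : x + y ≡ j
        x+y≡j = +-cancelʳ-≡ m (x + y) j (begin
          x + y + m             ≡⟨ cong (x + y +_) m≡σ+ρ ⟩
          (x + y) + (σ + ρ)     ≡⟨ interchange x y σ ρ ⟩
          (x + σ) + (y + ρ)     ≡⟨ cong₂ _+_ x+σ≡x′ (trans (+-comm y ρ) ρ+y≡y′) ⟩
          x′ + y′               ≡⟨ x′+y′≡j+m ⟩
          j + m                 ∎)
          where open ≡-Reasoning
        x≤width : x ≤ width g
        x≤width = ∸-monoˡ-≤ σ (≤-maxSupp g x′ gx′)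
        gx : 1 ≤ val g (x + σ)
        gx = subst (λ a → 1 ≤ val g a) (sym x+σ≡x′) gx′
        y≤ : y ≤ maxSupp f ∸ (width g + m)
        y≤ = m+n≤o⇒m≤o∸n y (begin
          y + (width g + m)     ≡⟨ cong (y +_) width+m≡maxSupp+ρ ⟩
          y + (maxSupp g + ρ)   ≡⟨ x∙yz≈y∙zx y (maxSupp g) ρ ⟩
          maxSupp g + (ρ + y)   ≡⟨ cong (maxSupp g +_) ρ+y≡y′ ⟩
          maxSupp g + y′        ≤⟨ ≤-maxSupp f _ (∈SA-sum 1≤b g h f s _ _ (val-maxSupp>0 g g≢0) hy′) ⟩
          maxSupp f             ∎)
          where open ≤-Reasoning

    encode-divides : ∀ k → maxSupp f ≤ k → Divides b (encode g) (interval k)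
    encode-divides k max≤k = interval (k ∸ M) , IsSum-interval (encode g) M k M≤k (encode-supp-≤ g) cover
      where
        M : ℕ
        M = width g + m
        M≤k : M ≤ k
        M≤k = ≤-trans width+m≤maxSupp max≤k
        0∈interval : 1 ≤ val (interval (k ∸ M)) 0
        0∈interval = from (∈interval (k ∸ M) 0) z≤n
        cover : ∀ a → a ≤ k → a ∈SA encode g ⊕ interval (k ∸ M) at 1
        cover a a≤k with M ≤? a | a ≤? width g
        ... | yes M≤a | _ = M , a ∸ M , m+[n∸m]≡n M≤a , encode>0 g M (code-top>0 g g≢0) ,
                            from (∈interval (k ∸ M) (a ∸ M)) (∸-monoˡ-≤ M a≤k)
        ... | no  M≰a | no a≰w = a , 0 , +-identityʳ a , encode>0 g a (code-mid>0 g (≰⇒> a≰w) (<⇒≤ (≰⇒> M≰a))) , 0∈interval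
        ... | no  _   | yes a≤w with 1≤n⊎n≡0 (val f (a + m))
        ...   | inj₂ fa≡0 = a , 0 , +-identityʳ a , encode>0 g a (≤-reflexive (sym (code-gap g a≤w fa≡0))) , 0∈interval
        ...   | inj₁ fa with split-shifted a fa
        ...     | x , y , x+y≡a , x≤w , gx , y≤ = x , y , x+y≡a , encode>0 g x (code-low>0 g x≤w gx) ,
                                                from (∈interval (k ∸ M) y) (≤-trans y≤ (∸-monoˡ-≤ M max≤k))

    gap⇒val≡0 : ∀ j → val f (j + m) ≡ 0 → val g (j + σ) ≡ 0
    gap⇒val≡0 j fj≡0 with 1≤n⊎n≡0 (val g (j + σ))
    ... | inj₁ gj    = ⊥-elim (n≮0 (subst (1 ≤_) fj≡0 (∈SA-shifted j gj)))
    ... | inj₂ gj≡0 = gj≡0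

  encode≡⇒width≡ : ∀ g₁ g₂ → Nonzero g₁ → Nonzero g₂ → encode g₁ ≡ encode g₂ → width g₁ ≡ width g₂
  encode≡⇒width≡ g₁ g₂ g₁≢0 g₂≢0 e =
    +-cancelʳ-≡ m _ _ (trans (sym (maxSupp-encode g₁ g₁≢0)) (trans (cong maxSupp e) (maxSupp-encode g₂ g₂≢0)))

  code≗⇒minSupp-≤ : ∀ g₁ g₂ → width g₁ ≡ width g₂ → minSupp g₂ ≤ m → (∀ j → code g₁ j ≡ code g₂ j) →
                      minSupp g₂ ≤ minSupp g₁
  code≗⇒minSupp-≤ g₁ g₂ w₁≡w₂ σ₂≤m code≗ with 1≤n⊎n≡0 (minSupp g₂)
  ... | inj₂ σ₂≡0 = subst (_≤ minSupp g₁) (sym σ₂≡0) z≤n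
  ... | inj₁ 1≤σ₂ = +-cancelˡ-≤ (width g₂) _ _ (subst (λ w → j ≤ w + minSupp g₁) w₁≡w₂ j≤w₁+σ₁)
    where
      j : ℕ
      j = width g₂ + minSupp g₂
      w₂<j : width g₂ < j
      w₂<j = subst (_≤ j) (+-comm (width g₂) 1) (+-monoʳ-≤ (width g₂) 1≤σ₂)
      code₂≡2 : code g₂ j ≡ 2
      code₂≡2 = code-run g₂ w₂<j (+-monoʳ-≤ (width g₂) σ₂≤m) ≤-refl
      j≤w₁+σ₁ : j ≤ width g₁ + minSupp g₁
      j≤w₁+σ₁ = code≡2⇒≤width+minSupp g₁ (subst (_< j) (sym w₁≡w₂) w₂<j) (trans (code≗ j) code₂≡2)

  module _ (f≢0 : Nonzero f) where

    encode-injective : ∀ {g₁ g₂} → Divides b g₁ f → Divides b g₂ f → encode g₁ ≡ encode g₂ → g₁ ≡ g₂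
    encode-injective {g₁} {g₂} (h₁ , s₁) (h₂ , s₂) e = 𝓜-ext g₁ g₂ pointwise
      where
        module D₁ = Divisor f≢0 g₁ h₁ s₁
        module D₂ = Divisor f≢0 g₂ h₂ s₂

        code≗ : ∀ j → code g₁ j ≡ code g₂ j
        code≗ j = trans (sym (val-encode g₁ j)) (trans (cong (λ e → val e j) e) (val-encode g₂ j))

        w₁≡w₂ : width g₁ ≡ width g₂
        w₁≡w₂ = encode≡⇒width≡ g₁ g₂ D₁.g≢0 D₂.g≢0 e

        σ₁≡σ₂ : minSupp g₁ ≡ minSupp g₂
        σ₁≡σ₂ = ≤-antisym (code≗⇒minSupp-≤ g₂ g₁ (sym w₁≡w₂) D₁.σ≤m (λ j → sym (code≗ j)))
                          (code≗⇒minSupp-≤ g₁ g₂ w₁≡w₂ D₂.σ≤m code≗)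

        τ₁≡τ₂ : maxSupp g₁ ≡ maxSupp g₂
        τ₁≡τ₂ = trans (sym (width+minSupp g₁ D₁.g≢0)) (trans (cong₂ _+_ w₁≡w₂ σ₁≡σ₂) (width+minSupp g₂ D₂.g≢0))

        shifted : ∀ j → j ≤ width g₁ → val g₁ (j + minSupp g₁) ≡ val g₂ (j + minSupp g₂)
        shifted j j≤w with 1≤n⊎n≡0 (val f (j + m))
        ... | inj₁ fj   = trans (sym (code-low g₁ j≤w fj)) (trans (code≗ j) (code-low g₂ (subst (j ≤_) w₁≡w₂ j≤w) fj))
        ... | inj₂ fj≡0 = trans (D₁.gap⇒val≡0 j fj≡0) (sym (D₂.gap⇒val≡0 j fj≡0))

        pointwise : ∀ x → val g₁ x ≡ val g₂ x
        pointwise x with x <? minSupp g₁ | maxSupp g₁ <? x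
        ... | yes x<σ₁ | _ =
          trans (<minSupp⇒val≡0 g₁ x x<σ₁) (sym (<minSupp⇒val≡0 g₂ x (subst (x <_) σ₁≡σ₂ x<σ₁)))
        ... | no _ | yes τ₁<x =
          trans (>maxSupp⇒val≡0 g₁ x τ₁<x) (sym (>maxSupp⇒val≡0 g₂ x (subst (_< x) τ₁≡τ₂ τ₁<x)))
        ... | no x≮σ₁ | no τ₁≮x =
          subst₂ (λ u v → val g₁ u ≡ val g₂ v) x≡₁ x≡₂ (shifted (x ∸ minSupp g₁) (∸-monoˡ-≤ (minSupp g₁) (≮⇒≥ τ₁≮x)))
          where
            x≡₁ : x ∸ minSupp g₁ + minSupp g₁ ≡ x
            x≡₁ = m∸n+n≡m (≮⇒≥ x≮σ₁)
            x≡₂ : x ∸ minSupp g₁ + minSupp g₂ ≡ x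
            x≡₂ = trans (cong (x ∸ minSupp g₁ +_) (sym σ₁≡σ₂)) x≡₁

    encode≡interval⇒width+m≡ : ∀ g → Divides b g f → ∀ {c} → encode g ≡ interval c → width g + m ≡ c
    encode≡interval⇒width+m≡ g (h , s) {c} eq =
      trans (sym (maxSupp-encode g (Divisor.g≢0 f≢0 g h s))) (trans (cong maxSupp eq) (maxSupp-interval c))

    encode≡interval-pred⇒successor-closed :
      m ≡ 0 → ∀ {k} → maxSupp f ≡ k → ∀ {g} → Divides b g f → encode g ≡ interval (k ∸ 1) →
      ∀ j → suc j ≤ k → 1 ≤ val f j → 1 ≤ val f (suc j)
    encode≡interval-pred⇒successor-closed m≡0 {k} max≡k {g} (h , s) eq j 1+j≤k fj =
      subst (λ a → 1 ≤ val f a) j+σ+1≡1+j (∈SA-sum 1≤b g h f s _ _ g[j+σ] h1)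
      where
        open Divisor f≢0 g h s
        w≡k-1 : width g ≡ k ∸ 1
        w≡k-1 = trans (sym (trans (cong (width g +_) m≡0) (+-identityʳ _))) (encode≡interval⇒width+m≡ g (h , s) eq)
        σ≡0 : σ ≡ 0
        σ≡0 = n≤0⇒n≡0 (subst (σ ≤_) m≡0 σ≤m)
        1≤k : 1 ≤ k
        1≤k = ≤-trans (s≤s z≤n) 1+j≤k
        j≤k-1 : j ≤ k ∸ 1
        j≤k-1 = ∸-monoˡ-≤ 1 1+j≤k
        g[j+σ] : 1 ≤ val g (j + σ)
        g[j+σ] = subst (1 ≤_) (trans (sym (cong (λ e → val e j) eq)) (trans (val-encode g j) (code-low g j≤w fj+m)))
                       (from (∈interval (k ∸ 1) j) j≤k-1)
          where
            j≤w : j ≤ width g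
            j≤w = subst (j ≤_) (sym w≡k-1) j≤k-1
            fj+m : 1 ≤ val f (j + m)
            fj+m = subst (λ a → 1 ≤ val f a) (sym (trans (cong (j +_) m≡0) (+-identityʳ j))) fj
        maxSupp-h≡1 : maxSupp h ≡ 1
        maxSupp-h≡1 = +-cancelˡ-≡ (k ∸ 1) _ _ (begin
          k ∸ 1 + maxSupp h       ≡⟨ cong (_+ maxSupp h) (trans (sym w≡k-1) (trans (sym (+-identityʳ _)) (cong (width g +_) (sym σ≡0)))) ⟩
          width g + σ + maxSupp h ≡⟨ cong (_+ maxSupp h) (width+minSupp g g≢0) ⟩
          maxSupp g + maxSupp h   ≡⟨ maxSupp-sum 1≤b g h f s f≢0 ⟨
          maxSupp f               ≡⟨ max≡k ⟩
          k                       ≡⟨ m∸n+n≡m 1≤k ⟨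
          k ∸ 1 + 1               ∎)
          where open ≡-Reasoning
        h1 : 1 ≤ val h 1
        h1 = subst (λ a → 1 ≤ val h a) maxSupp-h≡1 (val-maxSupp>0 h h≢0)
        j+σ+1≡1+j : j + σ + 1 ≡ suc j
        j+σ+1≡1+j = trans (cong (λ σ → j + σ + 1) σ≡0) (trans (cong (_+ 1) (+-identityʳ j)) (+-comm j 1))

    divisor-outside-image : ∀ k → maxSupp f ≤ k → ∀ x → x ≤ k → ¬ 1 ≤ val f x →
                     ∃[ e ] (Divides b e (interval k) × (∀ {g} → Divides b g f → encode g ≢ e))
    divisor-outside-image k max≤k x x≤k ¬fx with 1≤n⊎n≡0 m
    ... | inj₁ 1≤m = interval 0 , interval-divides 0 k z≤n ,
          λ {g} g∣f eq → n≮0 (subst (1 ≤_) (encode≡interval⇒width+m≡ g g∣f eq) (≤-trans 1≤m (m≤n+m m (width g))))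
    ... | inj₂ m≡0 with maxSupp f <? k
    ...   | yes max<k = interval k , interval-divides k k ≤-refl ,
          λ {g} (h , s) eq → <⇒≱ max<k (subst (_≤ maxSupp f) (encode≡interval⇒width+m≡ g (h , s) eq) (Divisor.width+m≤maxSupp f≢0 g h s))
    ...   | no  max≮k with boundary (λ a → 1 ≤? val f a) (subst (λ a → 1 ≤ val f a) m≡0 (val-minSupp>0 f f≢0)) x ¬fx
    ...     | j , 1+j≤x , fj , ¬f[1+j] =
          interval (k ∸ 1) , interval-divides (k ∸ 1) k (m∸n≤m k 1) ,
          λ {g} g∣f eq → ¬f[1+j] (encode≡interval-pred⇒successor-closed m≡0 (≤-antisym max≤k (≮⇒≥ max≮k)) {g} g∣f eq
                                                                        j (≤-trans 1+j≤x x≤k) fj)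

    encodeEmbedding : ∀ k → maxSupp f ≤ k → DivisorEmbedding f (interval k)
    encodeEmbedding k max≤k = record
      { embed           = encode
      ; embed-divides   = λ {g} (h , s) → Divisor.encode-divides f≢0 g h s k max≤k
      ; embed-injective = encode-injective
      }

mainTheorem12 : (b k : ℕ) → 2 ≤ b → (A : ℕ → Set) →
    (∀ a → A a → a ≤ k) → (∃[ a ] A a) →
    (f kb : 𝓜 b) → HasSetArray₁ b f A → HasSetArray₁ b kb (λ a → a ≤ k) →
    ∃[ gs ] ∃[ hs ] (IsDivisorList b f gs × IsDivisorList b kb hs ×
      length gs ≤ length hs × (f ≢ kb → length gs < length hs))
mainTheorem12 b k 2≤b A A⊆[k] (a , Aa) f kb hf hk =
  gs , hs , gs-ok , hs-ok , divisorList-length-≤ E gs-ok hs-ok′ , fewer-if-≢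
  where
    open Encoding 2≤b f
    open Intervals 1≤b

    f≢0 : Nonzero f
    f≢0 = a , from (proj₁ hf a) Aa

    max≤k : maxSupp f ≤ k
    max≤k = A⊆[k] _ (to (proj₁ hf _) (val-maxSupp>0 f f≢0))

    kb≡[k] : kb ≡ interval k
    kb≡[k] = HasSetArray₁-unique 2≤b hk (HasSetArray₁-interval k)

    gs hs : List (𝓜 b)
    gs = proj₁ (divisorList 1≤b f f≢0)
    hs = proj₁ (divisorList 1≤b kb (0 , from (proj₁ hk 0) z≤n))

    gs-ok : IsDivisorList b f gs
    gs-ok = proj₂ (divisorList 1≤b f f≢0)

    hs-ok : IsDivisorList b kb hs
    hs-ok = proj₂ (divisorList 1≤b kb (0 , from (proj₁ hk 0) z≤n))

    hs-ok′ : IsDivisorList b (interval k) hs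
    hs-ok′ = subst (λ e → IsDivisorList b e hs) kb≡[k] hs-ok

    E : DivisorEmbedding f (interval k)
    E = encodeEmbedding f≢0 k max≤k

    fewer-if-≢ : f ≢ kb → length gs < length hs
    fewer-if-≢ f≢kb with ≢interval⇒gap 2≤b hf A⊆[k] (λ f≡[k] → f≢kb (trans f≡[k] (sym kb≡[k])))
    ... | x , x≤k , ¬fx with divisor-outside-image f≢0 k max≤k x x≤k ¬fx
    ...   | e , e∣[k] , e∉image = divisorList-length-< E gs-ok hs-ok′ e∣[k] (λ {g} → e∉image {g})
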